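{- $\mathcal{D}$ is a computability predicate.
   Context: Terms of $\lambda\Pi/\mathcal{R}$: $t ::= s \mid x \mid f \mid \Pi x{:}t.t \mid t\,t \mid \lambda x{:}t.t$ with $f$ ranging over function symbols; $\mathcal{R}$ is a set of rules $f\,\vec l\to r$; $\to=\to_\beta\cup\to_{\mathcal{R}}$ is assumed locally confluent; $\mathrm{SN}$ is the set of terminating terms and $T{\downarrow}$ the normal form of $T\in\mathrm{SN}$. A term is neutral if it is of the form $(\lambda x{:}A.t)\,u\,\vec v$, $x\,\vec v$, or $f\,\vec v$ with $|\vec l|\le|\vec v|$ for every rule $f\,\vec l\to r\in\mathcal{R}$. A set $S$ of terms is a computability predicate if $S\subseteq\mathrm{SN}$, every one-step reduct of an element of $S$ is in $S$, and every neutral term all of whose one-step reducts are in $S$ is in $S$. $\Pi a\in P.Q(a)=\{t\mid\forall a\in P,\ t\,a\in Q(a)\}$. For a partial function $I$ from terms to sets of terms, $D(I)$ is the set of $T\in\mathrm{SN}$ such that whenever $T\to^*\Pi x{:}A.B$, $A\in\mathrm{dom}(I)$ and $B[x\mapsto a]\in\mathrm{dom}(I)$ for all $a\in I(A)$; $F(I)$ has domain $D(I)$, $F(I)(T)=\Pi a\in I(A).I(B[x\mapsto a])$ if $T{\downarrow}=\Pi x{:}A.B$ and $\mathrm{SN}$ otherwise. $\mathcal{I}$ is the least fixpoint of the monotone map $F$ (partial functions ordered by inclusion) and $\mathcal{D}=D(\mathcal{I})$. -}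

module Defs where

open import Level using (Level) renaming (suc to lsuc; zero to lzero)
open import Data.Nat using (ℕ; zero; suc; _≤_)
open import Data.List using (List; []; _∷_; map; length; foldl)
open import Data.Product using (Σ; ∃; _×_; _,_)
open import Data.Empty using (⊥)
open import Relation.Nullary using (¬_)
open import Relation.Binary.PropositionalEquality using (_≡_)

data Term (S F : Set) : Set where
  sort : S → Term S F
  var  : ℕ → Term S F
  fun  : F → Term S F
  pi   : Term S F → Term S F → Term S F   -- Π x:A. B  (B under one binder)
  app  : Term S F → Term S F → Term S F
  lam  : Term S F → Term S F → Term S F   -- λ x:A. t  (t under one binder)

module _ {S F : Set} where

  ext : (ℕ → ℕ) → ℕ → ℕ
  ext ρ zero    = zero
  ext ρ (suc n) = suc (ρ n)

  ren : (ℕ → ℕ) → Term S F → Term S F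
  ren ρ (sort s)  = sort s
  ren ρ (var x)   = var (ρ x)
  ren ρ (fun f)   = fun f
  ren ρ (pi A B)  = pi (ren ρ A) (ren (ext ρ) B)
  ren ρ (app t u) = app (ren ρ t) (ren ρ u)
  ren ρ (lam A t) = lam (ren ρ A) (ren (ext ρ) t)

  exts : (ℕ → Term S F) → ℕ → Term S F
  exts σ zero    = var zero
  exts σ (suc n) = ren suc (σ n)

  sub : (ℕ → Term S F) → Term S F → Term S F
  sub σ (sort s)  = sort s
  sub σ (var x)   = σ x
  sub σ (fun f)   = fun f
  sub σ (pi A B)  = pi (sub σ A) (sub (exts σ) B)
  sub σ (app t u) = app (sub σ t) (sub σ u)
  sub σ (lam A t) = lam (sub σ A) (sub (exts σ) t)

  _[_]₀ : Term S F → Term S F → Term S F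
  t [ u ]₀ = sub σ t
    where
    σ : ℕ → Term S F
    σ zero    = u
    σ (suc n) = var n

  apps : Term S F → List (Term S F) → Term S F
  apps t vs = foldl app t vs

-- Rewrite rules  f l⃗ → r  (pattern variables = free de Bruijn variables)
record Rule (S F : Set) : Set where
  constructor rule
  field
    head : F
    lhs  : List (Term S F)
    rhs  : Term S F
open Rule public

RuleSet : (S F : Set) → Set₁
RuleSet S F = Rule S F → Set

module _ {S F : Set} (R : RuleSet S F) where

  data _⟶_ : Term S F → Term S F → Set where
    beta  : ∀ A t u → app (lam A t) u ⟶ (t [ u ]₀)
    rew   : ∀ ρ → R ρ → (σ : ℕ → Term S F) →
            apps (fun (head ρ)) (map (sub σ) (lhs ρ)) ⟶ sub σ (rhs ρ)
    piL   : ∀ {A A'} B → A ⟶ A' → pi A B ⟶ pi A' B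
    piR   : ∀ A {B B'} → B ⟶ B' → pi A B ⟶ pi A B'
    appL  : ∀ {t t'} u → t ⟶ t' → app t u ⟶ app t' u
    appR  : ∀ t {u u'} → u ⟶ u' → app t u ⟶ app t u'
    lamL  : ∀ {A A'} t → A ⟶ A' → lam A t ⟶ lam A' t
    lamR  : ∀ A {t t'} → t ⟶ t' → lam A t ⟶ lam A t'

  data _⟶*_ : Term S F → Term S F → Set where
    refl* : ∀ {t} → t ⟶* t
    step* : ∀ {t u v} → t ⟶ u → u ⟶* v → t ⟶* v

  LocallyConfluent : Set
  LocallyConfluent = ∀ {t u v} → t ⟶ u → t ⟶ v → ∃ λ w → (u ⟶* w) × (v ⟶* w)

  data SN : Term S F → Set where
    sn : ∀ {t} → (∀ u → t ⟶ u → SN u) → SN t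

  Normal : Term S F → Set
  Normal t = ∀ u → ¬ (t ⟶ u)

  NormalFormOf : Term S F → Term S F → Set
  NormalFormOf T N = (T ⟶* N) × Normal N

  data Neutral : Term S F → Set where
    neu-β   : ∀ A t u vs → Neutral (apps (app (lam A t) u) vs)
    neu-var : ∀ x vs → Neutral (apps (var x) vs)
    neu-fun : ∀ f vs → (∀ ρ → R ρ → head ρ ≡ f → length (lhs ρ) ≤ length vs) →
              Neutral (apps (fun f) vs)

  record IsComputabilityPredicate (P : Term S F → Set) : Set where
    field
      ⊆SN     : ∀ t → P t → SN t
      closed  : ∀ t u → P t → t ⟶ u → P u
      neutral : ∀ t → Neutral t → (∀ u → t ⟶ u → P u) → P t

-- Partial functions from terms to sets of terms:
-- a domain and a value (only meaningful on the domain);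
-- val T t  means  t ∈ I(T).
record PFun (S F : Set) : Set₁ where
  field
    dom : Term S F → Set
    val : Term S F → Term S F → Set
open PFun public

module _ {S F : Set} where

  -- inclusion of partial functions (sets of terms compared extensionally)
  _⊑_ : PFun S F → PFun S F → Set
  I ⊑ J = (∀ T → dom I T → dom J T)
        × (∀ T → dom I T → ∀ t → (val I T t → val J T t) × (val J T t → val I T t))

  _≈P_ : PFun S F → PFun S F → Set
  I ≈P J = (I ⊑ J) × (J ⊑ I)

module _ {S F : Set} (R : RuleSet S F) where

  D : PFun S F → Term S F → Set
  D I T = SN R T × (∀ A B → _⟶*_ R T (pi A B) →
                     dom I A × (∀ a → val I A a → dom I (B [ a ]₀)))

  -- value of F(I) at a term whose normal form is N
  PiOrSN : PFun S F → Term S F → Term S F → Set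
  PiOrSN I (pi A B) t = ∀ a → val I A a → val I (B [ a ]₀) (app t a)
  PiOrSN I _        t = SN R t

  FI : PFun S F → PFun S F
  FI I = record
    { dom = D I
    ; val = λ T t → ∀ N → NormalFormOf R T N → PiOrSN I N t
    }

  IsLeastFixpoint : PFun S F → Set₁
  IsLeastFixpoint I = (FI I ≈P I) × (∀ J → FI J ≈P J → I ⊑ J)

module Submission where

open import Defs
open import Data.Empty using (⊥; ⊥-elim)
open import Data.List using (List; []; _∷_)
open import Data.Product using (_×_; _,_; proj₁; proj₂)
open import Relation.Nullary using (¬_)

module _ {S F : Set} where

  data IsPi : Term S F → Set where
    is-pi : ∀ A B → IsPi (pi A B)

  ¬IsPi-apps-app : ∀ t u (vs : List (Term S F)) → ¬ IsPi (apps (app t u) vs)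
  ¬IsPi-apps-app t u []       ()
  ¬IsPi-apps-app t u (v ∷ vs) = ¬IsPi-apps-app (app t u) v vs

  ¬IsPi-apps-head : ∀ {h} → ¬ IsPi h → ∀ (vs : List (Term S F)) → ¬ IsPi (apps h vs)
  ¬IsPi-apps-head ¬h []       = ¬h
  ¬IsPi-apps-head ¬h (v ∷ vs) = ¬IsPi-apps-app _ v vs

  Neutral⇒¬IsPi : (R : RuleSet S F) → ∀ {t} → Neutral R t → ¬ IsPi t
  Neutral⇒¬IsPi R (neu-β A t u vs)  = ¬IsPi-apps-app (lam A t) u vs
  Neutral⇒¬IsPi R (neu-var x vs)    = ¬IsPi-apps-head (λ ()) vs
  Neutral⇒¬IsPi R (neu-fun f vs _)  = ¬IsPi-apps-head (λ ()) vs

module _ {S F : Set} (R : RuleSet S F) (I : PFun S F) where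

  D-closed : ∀ t u → D R I t → _⟶_ R t u → D R I u
  D-closed t u (sn next , pis) t⟶u = next u t⟶u , λ A B u⟶*Π → pis A B (step* t⟶u u⟶*Π)

  -- A neutral term is not itself a Π, so its reductions to a Π all start with a step.
  D-neutral : ∀ t → Neutral R t → (∀ u → _⟶_ R t u → D R I u) → D R I t
  D-neutral t t-neutral reducts-D = sn (λ u t⟶u → proj₁ (reducts-D u t⟶u)) , pis
    where
    pis : ∀ A B → _⟶*_ R t (pi A B) →
          dom I A × (∀ a → val I A a → dom I (B [ a ]₀))
    pis A B refl*                   = ⊥-elim (Neutral⇒¬IsPi R t-neutral (is-pi A B))
    pis A B (step* {u = u} t⟶u u⟶*Π) = proj₂ (reducts-D u t⟶u) A B u⟶*Π

  D-isComputabilityPredicate : IsComputabilityPredicate R (D R I)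
  D-isComputabilityPredicate = record
    { ⊆SN     = λ t → proj₁
    ; closed  = D-closed
    ; neutral = D-neutral
    }

lemma21 : (S F : Set) (R : RuleSet S F) → LocallyConfluent R →
          (I : PFun S F) → IsLeastFixpoint R I →
          IsComputabilityPredicate R (D R I)
lemma21 S F R _ I _ = D-isComputabilityPredicate R I
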